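{- Let $G$ be a connected simple graph containing a vertex $a$ with $d_G(a)\geq 2$, fix any execution of Algorithm $\text{tree}(G)$, and let $r$ and $F$ be the rank function and forest associated with this execution (as defined in the context). If $uv$ is an edge of $G$ with $u\in V_2(F)$, then $r(u)\geq r(v)$.
   Context: All graphs are finite, undirected and simple. For a graph $H$ and $u\in V(H)$, $d_H(u)$ is the number of neighbors of $u$ in $H$, and $V_2(H)$ is the set of vertices $u$ of $H$ with $d_H(u)\geq 2$. For a tree $T$ that is a subgraph of $G$ and $u\in V(T)$, let $V_T(u)$ be the set of vertices $v\in V(G)\setminus V(T)$ with $uv\in E(G)$, and $E_T(u)=\{uv:v\in V_T(u)\}$; if $|V_T(u)|=1$, let $v_T(u)$ be its unique element. $T\cup E_T(u)$ is the tree obtained by adding the vertices $V_T(u)$ and edges $E_T(u)$ ("expanding $T$ at $u$"). $W_2(T)$ is the set of $u\in V(T)$ with $|V_T(u)|\geq 2$; $W_1(T)$ is the set of $u\in V(T)$ with $|V_T(u)|=1$ and $|V_{T\cup E_T(u)}(v_T(u))|\geq 2$; $W_0(T)$ is the set of $u\in V(T)$ with $|V_T(u)|=1$ and $|V_{T\cup E_T(u)}(v_T(u))|\leq 1$. Algorithm $\text{tree}(G)$: start with $T=\{a\}$; while $V(T)\neq V(G)$: if $W_2(T)\neq\varnothing$ let $u$ be an arbitrary vertex of $W_2(T)$; else if $W_1(T)\neq\varnothing$ let $u$ be an arbitrary vertex of $W_1(T)$; else let $u$ be the vertex of $W_0(T)$ that joined $V(T)$ most recently; then set $T:=T\cup E_T(u)$.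 Return $T$. For a fixed execution, let $T$ be the returned spanning tree, rooted at $a$, and for $v\neq a$ let $p(v)$ be the parent of $v$ in $T$. For each vertex $u$ at which the algorithm expands the tree, let $T_u$ be the current tree immediately before that expansion (so $u=p(v)$ iff $v\in V_{T_u}(u)$). Define ranks $r:V(G)\to\mathbb{Z}$ by $r(a)=1$ and, for each edge $uv$ of $T$ with $u=p(v)$: $r(v)=r(u)$ if $u\in W_2(T_u)$, and $r(v)=1+\max_{w\in V(T_u)} r(w)$ otherwise. Let $F$ be the spanning forest obtained from $T$ by deleting every edge $uv$ with $r(u)\neq r(v)$. -}

module Defs where

open import Data.Nat using (ℕ; zero; suc; _≤_; _⊔_)
open import Data.Fin using (Fin; _≟_)
open import Data.Bool using (Bool; true; false; _∨_; _∧_; not; if_then_else_)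
open import Data.List using (List; foldr; allFin)
open import Data.Product using (Σ; ∃; ∃-syntax; _×_; _,_)
open import Data.Sum using (_⊎_)
open import Relation.Nullary using (¬_)
open import Relation.Nullary.Decidable using (⌊_⌋)
open import Relation.Binary.PropositionalEquality using (_≡_; _≢_)
open import Relation.Binary.Construct.Closure.ReflexiveTransitive using (Star)

record Graph (n : ℕ) : Set where
  field
    adj    : Fin n → Fin n → Bool
    sym    : ∀ x y → adj x y ≡ adj y x
    irrefl : ∀ x → adj x x ≡ false
open Graph public

Edge : ∀ {n} → Graph n → Fin n → Fin n → Set
Edge G x y = adj G x y ≡ true

Connected : ∀ {n} → Graph n → Set
Connected G = ∀ x y → Star (Edge G) x y

AtLeast2 : ∀ {n} → (Fin n → Set) → Set
AtLeast2 P = ∃[ v ] ∃[ w ] (v ≢ w × P v × P w)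

Exactly1 : ∀ {n} → (Fin n → Set) → Fin n → Set
Exactly1 P v = P v × (∀ w → P w → w ≡ v)

AtMost1 : ∀ {n} → (Fin n → Set) → Set
AtMost1 P = ∀ v w → P v → P w → v ≡ w

Deg≥2 : ∀ {n} → Graph n → Fin n → Set
Deg≥2 G u = AtLeast2 (Edge G u)

record State (n : ℕ) : Set where
  field
    inT   : Fin n → Bool   -- membership in V(T)
    time  : Fin n → ℕ      -- step at which the vertex joined V(T)
    par   : Fin n → Fin n  -- parent p(v) (meaningless for the root)
    rank  : Fin n → ℕ      -- r(v) (meaningful for vertices of T)
    clock : ℕ              -- number of expansions performed so far
open State public

module _ {n : ℕ} (G : Graph n) where

  OutSet : (Fin n → Bool) → Fin n → Fin n → Set
  OutSet S u v = Edge G u v × S v ≡ false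

  Out : State n → Fin n → Fin n → Set
  Out s = OutSet (inT s)

  -- vertex set of T ∪ E_T(u) when V_T(u) = {v}
  addV : State n → Fin n → Fin n → Bool
  addV s v x = inT s x ∨ ⌊ x ≟ v ⌋

  W2 : State n → Fin n → Set
  W2 s u = inT s u ≡ true × AtLeast2 (Out s u)

  W1 : State n → Fin n → Set
  W1 s u = inT s u ≡ true ×
           (∃[ v ] (Exactly1 (Out s u) v × AtLeast2 (OutSet (addV s v) v)))

  W0 : State n → Fin n → Set
  W0 s u = inT s u ≡ true ×
           (∃[ v ] (Exactly1 (Out s u) v × AtMost1 (OutSet (addV s v) v)))

  maxRank : State n → ℕ
  maxRank s = foldr (λ w acc → if inT s w then rank s w ⊔ acc else acc) 0 (allFin n)

  expand : State n → Fin n → ℕ → State n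
  expand s u ρ = record
    { inT   = λ x → inT s x ∨ adj G u x
    ; time  = λ x → if new x then suc (clock s) else time s x
    ; par   = λ x → if new x then u else par s x
    ; rank  = λ x → if new x then ρ else rank s x
    ; clock = suc (clock s)
    }
    where
    new : Fin n → Bool
    new x = not (inT s x) ∧ adj G u x

  data Step (s : State n) : State n → Set where
    stepW2 : ∀ u → W2 s u → Step s (expand s u (rank s u))
    stepW1 : ∀ u → (∀ w → ¬ W2 s w) → W1 s u →
             Step s (expand s u (suc (maxRank s)))
    stepW0 : ∀ u → (∀ w → ¬ W2 s w) → (∀ w → ¬ W1 s w) → W0 s u →
             (∀ w → W0 s w → time s w ≤ time s u) →
             Step s (expand s u (suc (maxRank s)))

  initState : Fin n → State n
  initState a = record
    { inT   = λ x → ⌊ x ≟ a ⌋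
    ; time  = λ _ → 0
    ; par   = λ _ → a
    ; rank  = λ _ → 1
    ; clock = 0
    }

  Spanning : State n → Set
  Spanning s = ∀ x → inT s x ≡ true

  Execution : Fin n → State n → Set
  Execution a s = Star Step (initState a) s × Spanning s

  TreeEdge : Fin n → State n → Fin n → Fin n → Set
  TreeEdge a s x y = (y ≢ a × par s y ≡ x) ⊎ (x ≢ a × par s x ≡ y)

  FEdge : Fin n → State n → Fin n → Fin n → Set
  FEdge a s x y = TreeEdge a s x y × rank s x ≡ rank s y

  InV2F : Fin n → State n → Fin n → Set
  InV2F a s u = AtLeast2 (FEdge a s u)

{-# OPTIONS --safe #-}
module Submission where

-- A vertex u of V₂(F) has an F-neighbour y that is its child in T, since at most
-- one of its two F-neighbours is its parent. The edge uy lies in F exactly when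
-- u was expanded as a vertex of W₂, because otherwise y receives a rank larger
-- than every rank present, in particular r(u). A vertex of W₂ carries the maximal
-- rank of the current tree, so when u is expanded all its old neighbours have
-- rank ≤ r(u), and the new ones get rank r(u). Ranks never change afterwards.

open import Defs hiding (sym)
open import Data.Nat using (ℕ; _≤_; suc; _⊔_)
open import Data.Nat.Properties using (≤-refl; ≤-trans; m≤m⊔n; m≤n⊔m; m≤n⇒m≤1+n)
open import Data.Fin using (Fin; _≟_)
open import Data.Bool using (true; false; if_then_else_)
open import Data.Bool.Properties using (∨-zeroʳ; ∨-conicalˡ)
open import Data.List using (List; _∷_; foldr; allFin)
open import Data.List.Relation.Unary.Any using (here; there)
open import Data.List.Membership.Propositional using (_∈_)
open import Data.List.Membership.Propositional.Properties using (∈-allFin)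
open import Data.Product using (∃-syntax; _×_; _,_; proj₁; proj₂)
open import Data.Sum using (_⊎_; inj₁; inj₂)
open import Data.Empty using (⊥-elim)
open import Relation.Nullary using (¬_; yes; no)
open import Relation.Binary.PropositionalEquality
  using (_≡_; _≢_; refl; sym; trans; subst; subst₂)
open import Relation.Binary.Construct.Closure.ReflexiveTransitive using (Star; ε; _◅_)

module _ {n : ℕ} (G : Graph n) where

  rank≤foldr : (s : State n) (xs : List (Fin n)) {x : Fin n} → x ∈ xs → inT s x ≡ true →
               rank s x ≤ foldr (λ w acc → if inT s w then rank s w ⊔ acc else acc) 0 xs
  rank≤foldr s (x ∷ xs) (here refl) x∈T rewrite x∈T = m≤m⊔n (rank s x) _
  rank≤foldr s (w ∷ xs) (there x∈xs) x∈T with inT s w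
  ... | true  = ≤-trans (rank≤foldr s xs x∈xs x∈T) (m≤n⊔m (rank s w) _)
  ... | false = rank≤foldr s xs x∈xs x∈T

  rank≤maxRank : (s : State n) {x : Fin n} → inT s x ≡ true → rank s x ≤ maxRank G s
  rank≤maxRank s {x} = rank≤foldr s (allFin n) (∈-allFin x)

  module Expansion (s : State n) (u₀ : Fin n) (ρ : ℕ) where

    s′ : State n
    s′ = expand G s u₀ ρ

    ∈-expand-old : ∀ {x} → inT s x ≡ true → inT s′ x ≡ true
    ∈-expand-old x∈T rewrite x∈T = refl

    ∈-expand-new : ∀ {x} → Edge G u₀ x → inT s′ x ≡ true
    ∈-expand-new {x} e rewrite e = ∨-zeroʳ (inT s x)

    ∈-expand⁻ : ∀ {x} → inT s′ x ≡ true →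
                inT s x ≡ true ⊎ (inT s x ≡ false × Edge G u₀ x)
    ∈-expand⁻ {x} x∈T′ with inT s x
    ... | true  = inj₁ refl
    ... | false = inj₂ (refl , x∈T′)

    rank-old : ∀ {x} → inT s x ≡ true → rank s′ x ≡ rank s x
    rank-old x∈T rewrite x∈T = refl

    par-old : ∀ {x} → inT s x ≡ true → par s′ x ≡ par s x
    par-old x∈T rewrite x∈T = refl

    rank-new : ∀ {x} → inT s x ≡ false → Edge G u₀ x → rank s′ x ≡ ρ
    rank-new x∉T e rewrite x∉T | e = refl

    par-new : ∀ {x} → inT s x ≡ false → Edge G u₀ x → par s′ x ≡ u₀
    par-new x∉T e rewrite x∉T | e = refl

    W2-expand⁻ : ∀ {u} → W2 G s′ u → inT s u ≡ true → W2 G s u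
    W2-expand⁻ (_ , v , w , v≢w , out-v , out-w) u∈T =
      u∈T , v , w , v≢w , shrink out-v , shrink out-w
      where
      shrink : ∀ {x} → Out G s′ _ x → Out G s _ x
      shrink {x} (e , x∉T′) = e , ∨-conicalˡ (inT s x) (adj G u₀ x) x∉T′

  Dominates : State n → Fin n → Set
  Dominates s u = ∀ v → Edge G u v → inT s v ≡ true × rank s v ≤ rank s u

  record Invariant (a : Fin n) (s : State n) : Set where
    field
      W2-rank-maximal : ∀ u w → W2 G s u → inT s w ≡ true → rank s w ≤ rank s u
      parent-in-tree  : ∀ y → y ≢ a → inT s y ≡ true → inT s (par s y) ≡ true
      rank-parent-dominates : ∀ y → y ≢ a → inT s y ≡ true →
                              rank s y ≡ rank s (par s y) → Dominates s (par s y)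
  open Invariant

  module Preservation (a : Fin n) (s : State n) (u₀ : Fin n) (ρ : ℕ)
                      (u₀∈T : inT s u₀ ≡ true)
                      (ρ-upper : ∀ w → inT s w ≡ true → rank s w ≤ ρ)
                      (ρ-lower : ∀ u → W2 G s u → ρ ≤ rank s u)
                      (I : Invariant a s) where
    open Expansion s u₀ ρ

    ρ-upper′ : ∀ w → inT s′ w ≡ true → rank s′ w ≤ ρ
    ρ-upper′ w w∈T′ with ∈-expand⁻ w∈T′
    ... | inj₁ w∈T rewrite rank-old w∈T = ρ-upper w w∈T
    ... | inj₂ (w∉T , e) rewrite rank-new w∉T e = ≤-refl

    ρ-lower′ : ∀ u → W2 G s′ u → ρ ≤ rank s′ u
    ρ-lower′ u u∈W2 with ∈-expand⁻ (proj₁ u∈W2)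
    ... | inj₁ u∈T rewrite rank-old u∈T = ρ-lower u (W2-expand⁻ u∈W2 u∈T)
    ... | inj₂ (u∉T , e) rewrite rank-new u∉T e = ≤-refl

    dominates-old : ∀ {u} → inT s u ≡ true → Dominates s u → Dominates s′ u
    dominates-old u∈T dom v e =
      let v∈T , v≤u = dom v e
      in ∈-expand-old v∈T , subst₂ _≤_ (sym (rank-old v∈T)) (sym (rank-old u∈T)) v≤u

    dominates-expanded : ρ ≡ rank s u₀ → Dominates s′ u₀
    dominates-expanded ρ≡r v e =
      ∈-expand-new e ,
      subst (rank s′ v ≤_) (trans ρ≡r (sym (rank-old u₀∈T))) (ρ-upper′ v (∈-expand-new e))

    parent-in-tree′ : ∀ y → y ≢ a → inT s′ y ≡ true → inT s′ (par s′ y) ≡ true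
    parent-in-tree′ y y≢a y∈T′ with ∈-expand⁻ y∈T′
    ... | inj₁ y∈T rewrite par-old y∈T = ∈-expand-old (parent-in-tree I y y≢a y∈T)
    ... | inj₂ (y∉T , e) rewrite par-new y∉T e = ∈-expand-old u₀∈T

    rank-parent-dominates′ : ∀ y → y ≢ a → inT s′ y ≡ true →
                             rank s′ y ≡ rank s′ (par s′ y) → Dominates s′ (par s′ y)
    rank-parent-dominates′ y y≢a y∈T′ r≡ with ∈-expand⁻ y∈T′
    ... | inj₁ y∈T rewrite par-old y∈T =
      let p∈T = parent-in-tree I y y≢a y∈T
          r≡′ = trans (sym (rank-old y∈T)) (trans r≡ (rank-old p∈T))
      in dominates-old p∈T (rank-parent-dominates I y y≢a y∈T r≡′)
    ... | inj₂ (y∉T , e) rewrite par-new y∉T e =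
      dominates-expanded (trans (sym (rank-new y∉T e)) (trans r≡ (rank-old u₀∈T)))

    invariant : Invariant a s′
    invariant = record
      { W2-rank-maximal       = λ u w u∈W2 w∈T′ → ≤-trans (ρ-upper′ w w∈T′) (ρ-lower′ u u∈W2)
      ; parent-in-tree        = parent-in-tree′
      ; rank-parent-dominates = rank-parent-dominates′
      }

  invariant-fresh-rank : (a : Fin n) (s : State n) (u₀ : Fin n) → inT s u₀ ≡ true →
                         (∀ w → ¬ W2 G s w) → Invariant a s →
                         Invariant a (expand G s u₀ (suc (maxRank G s)))
  invariant-fresh-rank a s u₀ u₀∈T noW2 =
    Preservation.invariant a s u₀ (suc (maxRank G s)) u₀∈T
      (λ w w∈T → m≤n⇒m≤1+n (rank≤maxRank s w∈T))
      (λ u u∈W2 → ⊥-elim (noW2 u u∈W2))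

  invariant-step : (a : Fin n) {s t : State n} → Step G s t → Invariant a s → Invariant a t
  invariant-step a {s} (stepW2 u₀ u₀∈W2) I =
    Preservation.invariant a s u₀ (rank s u₀) (proj₁ u₀∈W2)
      (λ w → W2-rank-maximal I u₀ w u₀∈W2)
      (λ u u∈W2 → W2-rank-maximal I u u₀ u∈W2 (proj₁ u₀∈W2)) I
  invariant-step a (stepW1 u₀ noW2 u₀∈W1)     = invariant-fresh-rank a _ u₀ (proj₁ u₀∈W1) noW2
  invariant-step a (stepW0 u₀ noW2 _ u₀∈W0 _) = invariant-fresh-rank a _ u₀ (proj₁ u₀∈W0) noW2

  initial-vertex≡root : (a : Fin n) {y : Fin n} → inT (initState G a) y ≡ true → y ≡ a
  initial-vertex≡root a {y} y∈T with y ≟ a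
  ... | yes y≡a = y≡a
  initial-vertex≡root a {y} () | no _

  invariant-initial : (a : Fin n) → Invariant a (initState G a)
  invariant-initial a = record
    { W2-rank-maximal       = λ _ _ _ _ → ≤-refl
    ; parent-in-tree        = λ y y≢a y∈T → ⊥-elim (y≢a (initial-vertex≡root a y∈T))
    ; rank-parent-dominates = λ y y≢a y∈T _ → ⊥-elim (y≢a (initial-vertex≡root a y∈T))
    }

  invariant-execution : (a : Fin n) {s t : State n} → Star (Step G) s t →
                        Invariant a s → Invariant a t
  invariant-execution a ε           I = I
  invariant-execution a (st ◅ sts) I = invariant-execution a sts (invariant-step a st I)

  V2F-child : (a : Fin n) (s : State n) {u : Fin n} → InV2F G a s u →
              ∃[ y ] (y ≢ a × par s y ≡ u × rank s u ≡ rank s y)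
  V2F-child a s (v , _ , _ , (inj₁ (v≢a , pv≡u) , r≡) , _) = v , v≢a , pv≡u , r≡
  V2F-child a s (_ , w , _ , (inj₂ _ , _) , (inj₁ (w≢a , pw≡u) , r≡)) = w , w≢a , pw≡u , r≡
  V2F-child a s (_ , _ , v≢w , (inj₂ (_ , pu≡v) , _) , (inj₂ (_ , pu≡w) , _)) =
    ⊥-elim (v≢w (trans (sym pu≡v) pu≡w))

lemma3 : ∀ {n : ℕ} (G : Graph n) (a : Fin n) (s : State n) →
         Connected G → Deg≥2 G a → Execution G a s →
         ∀ u v → Edge G u v → InV2F G a s u →
         rank s v ≤ rank s u
lemma3 G a s _ _ (run , spanning) u v e u∈V2F
  with V2F-child G a s u∈V2F
... | y , y≢a , refl , r≡ =
  proj₂ (Invariant.rank-parent-dominates I y y≢a (spanning y) (sym r≡) v e)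
  where
  I : Invariant G a s
  I = invariant-execution G a run (invariant-initial G a)
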